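{- Let $\mathbb{F}_\omega$ be the free group with basis $e_1,e_2,\ldots$. Fix $n\in\mathbb{N}$ and for $i,j,k,l\in\{1,\ldots,n\}$ set $$a_{ij}:=e_{i+j}^5e_i,\qquad b_{kl}:=e_k^{ -1}e_{k+l}^{ -4}.$$ If $i\ne k$ or $(i,j)=(k,l)$, then $a_{ij}$ and $b_{kl}$ are two distinct elements forming part of a basis of $\mathbb{F}_\omega$.
   Context: A basis of a free group is a free generating set. -}

module Defs where

open import Level using (0ℓ)
open import Data.Nat using (ℕ; zero; suc; _+_; _≡ᵇ_; pred)
open import Data.Bool using (Bool; true; false; _∧_; _xor_; if_then_else_; not)
open import Data.Product using (Σ; _×_; _,_; proj₁; proj₂)
open import Data.List using (List; []; _∷_; _++_; foldr; map; reverse)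
open import Data.Fin using (Fin; toℕ)
open import Relation.Binary.PropositionalEquality using (_≡_; _≢_)
open import Algebra.Bundles using (Group)

-- A letter (m , s) stands for e_{m+1}^{+1} if s = true and e_{m+1}^{-1}
-- if s = false.  Elements of F_ω are words modulo free reduction: two
-- words are equal in F_ω iff they have the same reduced form.

Letter : Set
Letter = ℕ × Bool

Word : Set
Word = List Letter

cancels : Letter → Letter → Bool
cancels (m , s) (m′ , s′) = (m ≡ᵇ m′) ∧ (s xor s′)

push : Letter → Word → Word
push x []      = x ∷ []
push x (y ∷ w) = if cancels x y then w else x ∷ y ∷ w

reduce : Word → Word
reduce = foldr push []

infix 4 _≈F_
_≈F_ : Word → Word → Set
w ≈F v = reduce w ≡ reduce v

infixl 7 _·_
_·_ : Word → Word → Word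
_·_ = _++_

-- the basis element e_i  (meaningful for i ≥ 1; e_i is the letter (i-1 , true))
e : ℕ → Word
e i = (pred i , true) ∷ []

e⁻¹ : ℕ → Word
e⁻¹ i = (pred i , false) ∷ []

IsHom : (G : Group 0ℓ 0ℓ) → (Word → Group.Carrier G) → Set
IsHom G h = (∀ w v → w ≈F v → h w ≈ h v) × (∀ w v → h (w · v) ≈ h w ∙ h v)
  where open Group G

IsBasis : {I : Set} → (I → Word) → Set₁
IsBasis {I} β =
  (G : Group 0ℓ 0ℓ) (f : I → Group.Carrier G) →
    Σ (Word → Group.Carrier G) (λ h → IsHom G h × (∀ i → Group._≈_ G (h (β i)) (f i)))
  × ((h h′ : Word → Group.Carrier G) → IsHom G h → IsHom G h′
      → (∀ i → Group._≈_ G (h (β i)) (f i))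
      → (∀ i → Group._≈_ G (h′ (β i)) (f i))
      → ∀ w → Group._≈_ G (h w) (h′ w))

PartOfBasis : Word → Word → Set₁
PartOfBasis x y =
  Σ Set λ I → Σ (I → Word) λ β → IsBasis β ×
    Σ I λ p → Σ I λ q → (p ≢ q) × (β p ≈F x) × (β q ≈F y)

ι : {n : ℕ} → Fin n → ℕ
ι i = suc (toℕ i)

a : {n : ℕ} → Fin n → Fin n → Word
a i j = e (ι i + ι j) · e (ι i + ι j) · e (ι i + ι j) · e (ι i + ι j) · e (ι i + ι j) · e (ι i)

b : {n : ℕ} → Fin n → Fin n → Word
b k l = e⁻¹ (ι k) · e⁻¹ (ι k + ι l) · e⁻¹ (ι k + ι l) · e⁻¹ (ι k + ι l) · e⁻¹ (ι k + ι l)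

module Submission where

-- Substitutions ℕ → Word act on words as endomorphisms of F, and a basis
-- composed with an invertible substitution is again a basis.  The Nielsen
-- move "replace the generator x_r by a word W in which x_r occurs exactly
-- once" is invertible, hence preserves bases.
-- For i ≠ k the elements a_ij and b_kl arise from the standard basis by two
-- such moves acting on different generators (e_i for a, e_k for b, in a
-- suitable order).  For (i,j) = (k,l) we first replace e_i by b_ij and then
-- e_{i+j} by e_{i+j} e_i^{-1}, which turns it into e_{i+j}·b_ij^{-1} = a_ij.
-- Finally a_ij ≠ b_kl because their exponent sums are 6 and −5.

open import Level using (0ℓ)
open import Defs
open import Data.Nat using (ℕ; suc; _+_; _≟_; _<_; z<s)
open import Data.Nat.Properties using (≡ᵇ⇒≡; ≡⇒≡ᵇ; m<m+n; <-trans; >⇒≢)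
open import Data.Bool using (Bool; true; false; _xor_; not)
open import Data.Bool.Properties using (∧-conicalˡ; ∧-conicalʳ; T-≡)
open import Data.Unit using (⊤; tt)
open import Data.Empty using (⊥-elim)
open import Data.Fin using (Fin; toℕ)
open import Data.Fin.Properties using (toℕ-injective)
open import Data.Product using (_×_; _,_; proj₁; proj₂)
open import Data.Sum using (_⊎_; inj₁; inj₂)
open import Data.List using ([]; _∷_; _++_; foldr)
open import Data.List.Properties using (++-assoc; ++-identityʳ)
open import Data.List.Relation.Unary.All as All using (All; []; _∷_)
open import Data.List.Relation.Unary.All.Properties using (++⁺)
open import Function using (Equivalence)
open import Relation.Nullary using (¬_; yes; no)
open import Relation.Binary.PropositionalEquality
  using (_≡_; _≢_; refl; sym; trans; cong; cong₂; subst; ≢-sym; module ≡-Reasoning)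
open import Algebra.Bundles using (Group; AbelianGroup)
import Algebra.Properties.Group as GroupProperties
open import Data.Integer using (ℤ; +_)
open import Data.Integer.Properties using (+-0-abelianGroup)

invL : Letter → Letter
invL (m , s) = m , not s

invL-involutive : ∀ x → invL (invL x) ≡ x
invL-involutive (m , true)  = refl
invL-involutive (m , false) = refl

xor-true : ∀ s t → s xor t ≡ true → t ≡ not s
xor-true true  false _ = refl
xor-true false true  _ = refl
xor-true true  true  ()
xor-true false false ()

cancels⇒invL : ∀ x y → cancels x y ≡ true → y ≡ invL x
cancels⇒invL (m , s) (m′ , s′) c =
  cong₂ _,_ (sym (≡ᵇ⇒≡ m m′ (Equivalence.from T-≡ (∧-conicalˡ _ _ c))))
            (xor-true s s′ (∧-conicalʳ _ _ c))

cancels-invL : ∀ x → cancels x (invL x) ≡ true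
cancels-invL (m , s) rewrite Equivalence.to T-≡ (≡⇒≡ᵇ m m refl) = xor-not s
  where
  xor-not : ∀ s → s xor not s ≡ true
  xor-not true  = refl
  xor-not false = refl

Reduced : Word → Set
Reduced []          = ⊤
Reduced (x ∷ [])    = ⊤
Reduced (x ∷ y ∷ w) = cancels x y ≡ false × Reduced (y ∷ w)

reduced-tail : ∀ x w → Reduced (x ∷ w) → Reduced w
reduced-tail x []      _       = tt
reduced-tail x (y ∷ w) (_ , r) = r

push-reduced : ∀ x w → Reduced w → Reduced (push x w)
push-reduced x []      _ = tt
push-reduced x (y ∷ w) r with cancels x y in c
... | true  = reduced-tail y w r
... | false = c , r

push-onto-reduced : ∀ x w → Reduced (x ∷ w) → push x w ≡ x ∷ w
push-onto-reduced x []      _       = refl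
push-onto-reduced x (y ∷ w) (c , _) rewrite c = refl

push-invL : ∀ x w → Reduced w → push x (push (invL x) w) ≡ w
push-invL x []      _ rewrite cancels-invL x = refl
push-invL x (y ∷ w) r with cancels (invL x) y in c
... | true with trans (cancels⇒invL (invL x) y c) (invL-involutive x)
...   | refl = push-onto-reduced x w r
push-invL x (y ∷ w) r | false rewrite cancels-invL x = refl

push-cancel : ∀ x y w → cancels x y ≡ true → Reduced w → push x (push y w) ≡ w
push-cancel x y w c r with cancels⇒invL x y c
... | refl = push-invL x w r

-- Reduction relative to a reduced tail: pushAll u w is the reduced form of
-- w · u when u is reduced.  In particular reduce = pushAll [].

pushAll : Word → Word → Word
pushAll u w = foldr push u w

pushAll-reduced : ∀ w {u} → Reduced u → Reduced (pushAll u w)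
pushAll-reduced []      r = r
pushAll-reduced (x ∷ w) r = push-reduced x _ (pushAll-reduced w r)

reduce-reduced : ∀ w → Reduced (reduce w)
reduce-reduced w = pushAll-reduced w {[]} tt

pushAll-push : ∀ x w u → Reduced u → pushAll u (push x w) ≡ push x (pushAll u w)
pushAll-push x []      u r = refl
pushAll-push x (y ∷ w) u r with cancels x y in c
... | true  = sym (push-cancel x y (pushAll u w) c (pushAll-reduced w r))
... | false = refl

pushAll-reduce : ∀ w u → Reduced u → pushAll u w ≡ pushAll u (reduce w)
pushAll-reduce []      u r = refl
pushAll-reduce (x ∷ w) u r =
  trans (cong (push x) (pushAll-reduce w u r)) (sym (pushAll-push x (reduce w) u r))

reduce-++ : ∀ w v → reduce (w ++ v) ≡ pushAll (reduce v) w
reduce-++ []      v = refl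
reduce-++ (x ∷ w) v = cong (push x) (reduce-++ w v)

++-cong : ∀ {w w′ v v′} → w ≈F w′ → v ≈F v′ → (w ++ v) ≈F (w′ ++ v′)
++-cong {w} {w′} {v} {v′} w≈w′ v≈v′ = begin
  reduce (w ++ v)                ≡⟨ reduce-++ w v ⟩
  pushAll (reduce v) w           ≡⟨ pushAll-reduce w _ (reduce-reduced v) ⟩
  pushAll (reduce v) (reduce w)  ≡⟨ cong₂ pushAll v≈v′ w≈w′ ⟩
  pushAll (reduce v′) (reduce w′) ≡⟨ sym (pushAll-reduce w′ _ (reduce-reduced v′)) ⟩
  pushAll (reduce v′) w′         ≡⟨ sym (reduce-++ w′ v′) ⟩
  reduce (w′ ++ v′)              ∎
  where open ≡-Reasoning

inv : Word → Word
inv []      = []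
inv (x ∷ w) = inv w ++ invL x ∷ []

inv-++ : ∀ w v → inv (w ++ v) ≡ inv v ++ inv w
inv-++ []      v = sym (++-identityʳ (inv v))
inv-++ (x ∷ w) v = trans (cong (_++ invL x ∷ []) (inv-++ w v)) (++-assoc (inv v) (inv w) _)

inv-involutive : ∀ w → inv (inv w) ≡ w
inv-involutive []      = refl
inv-involutive (x ∷ w) =
  trans (inv-++ (inv w) (invL x ∷ [])) (cong₂ _∷_ (invL-involutive x) (inv-involutive w))

inv-cancelˡ : ∀ w v → (inv w ++ w ++ v) ≈F v
inv-cancelˡ []      v = refl
inv-cancelˡ (x ∷ w) v = begin
  reduce ((inv w ++ invL x ∷ []) ++ x ∷ w ++ v)  ≡⟨ cong reduce (++-assoc (inv w) _ _) ⟩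
  reduce (inv w ++ invL x ∷ x ∷ w ++ v)          ≡⟨ reduce-++ (inv w) _ ⟩
  pushAll (push (invL x) (push x (reduce (w ++ v)))) (inv w)
    ≡⟨ cong (λ t → pushAll t (inv w)) (push-cancel (invL x) x _ invL-cancels (reduce-reduced (w ++ v))) ⟩
  pushAll (reduce (w ++ v)) (inv w)              ≡⟨ sym (reduce-++ (inv w) (w ++ v)) ⟩
  reduce (inv w ++ w ++ v)                       ≡⟨ inv-cancelˡ w v ⟩
  reduce v                                       ∎
  where
  open ≡-Reasoning
  invL-cancels : cancels (invL x) x ≡ true
  invL-cancels = subst (λ y → cancels (invL x) y ≡ true) (invL-involutive x) (cancels-invL (invL x))

inv-cancelʳ : ∀ w v → (w ++ inv w ++ v) ≈F v
inv-cancelʳ []      v = refl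
inv-cancelʳ (x ∷ w) v = begin
  push x (reduce (w ++ (inv w ++ invL x ∷ []) ++ v))
    ≡⟨ cong (λ t → push x (reduce (w ++ t))) (++-assoc (inv w) _ v) ⟩
  push x (reduce (w ++ inv w ++ invL x ∷ v))  ≡⟨ cong (push x) (inv-cancelʳ w (invL x ∷ v)) ⟩
  push x (push (invL x) (reduce v))           ≡⟨ push-invL x _ (reduce-reduced v) ⟩
  reduce v                                    ∎
  where open ≡-Reasoning

inv-inverseˡ : ∀ w → (inv w ++ w) ≈F []
inv-inverseˡ w = trans (cong (λ t → reduce (inv w ++ t)) (sym (++-identityʳ w))) (inv-cancelˡ w [])

inv-inverseʳ : ∀ w → (w ++ inv w) ≈F []
inv-inverseʳ w = trans (cong (λ t → reduce (w ++ t)) (sym (++-identityʳ (inv w)))) (inv-cancelʳ w [])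

inv-cong : ∀ {w v} → w ≈F v → inv w ≈F inv v
inv-cong {w} {v} w≈v = begin
  reduce (inv w)                ≡⟨ sym (inv-cancelˡ v (inv w)) ⟩
  reduce (inv v ++ v ++ inv w)  ≡⟨ ++-cong {inv v} {inv v} {v ++ inv w} refl (++-cong {v} {w} {inv w} (sym w≈v) refl) ⟩
  reduce (inv v ++ w ++ inv w)  ≡⟨ ++-cong {inv v} {inv v} {w ++ inv w} refl (inv-inverseʳ w) ⟩
  reduce (inv v ++ [])          ≡⟨ cong reduce (++-identityʳ (inv v)) ⟩
  reduce (inv v)                ∎
  where open ≡-Reasoning

F : Group 0ℓ 0ℓ
F = record
  { Carrier = Word ; _≈_ = _≈F_ ; _∙_ = _++_ ; ε = [] ; _⁻¹ = inv
  ; isGroup = record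
    { isMonoid = record
      { isSemigroup = record
        { isMagma = record
          { isEquivalence = record { refl = refl ; sym = sym ; trans = trans }
          ; ∙-cong = λ {w} {w′} {v} {v′} → ++-cong {w} {w′} {v} {v′} }
        ; assoc = λ w v u → cong reduce (++-assoc w v u) }
      ; identity = (λ w → refl) , (λ w → cong reduce (++-identityʳ w)) }
    ; inverse = inv-inverseˡ , inv-inverseʳ
    ; ⁻¹-cong = λ {w} {v} → inv-cong {w} {v} } }

module Evaluation (G : Group 0ℓ 0ℓ) where
  open Group G renaming (refl to ≈-refl; sym to ≈-sym; trans to ≈-trans)
  open GroupProperties G using (identityʳ-unique; inverseˡ-unique)
  open import Relation.Binary.Reasoning.Setoid setoid

  evL : (ℕ → Carrier) → Letter → Carrier
  evL f (m , true)  = f m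
  evL f (m , false) = f m ⁻¹

  ev : (ℕ → Carrier) → Word → Carrier
  ev f []      = ε
  ev f (x ∷ w) = evL f x ∙ ev f w

  ev-++ : ∀ f w v → ev f (w ++ v) ≈ ev f w ∙ ev f v
  ev-++ f []      v = ≈-sym (identityˡ _)
  ev-++ f (x ∷ w) v = ≈-trans (∙-congˡ (ev-++ f w v)) (≈-sym (assoc _ _ _))

  evL-invL : ∀ f x → evL f x ∙ evL f (invL x) ≈ ε
  evL-invL f (m , true)  = inverseʳ (f m)
  evL-invL f (m , false) = inverseˡ (f m)

  ev-push : ∀ f x w → ev f (push x w) ≈ evL f x ∙ ev f w
  ev-push f x []      = ≈-refl
  ev-push f x (y ∷ w) with cancels x y in c
  ... | false = ≈-refl
  ... | true with cancels⇒invL x y c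
  ...   | refl = begin
    ev f w                                ≈⟨ ≈-sym (identityˡ _) ⟩
    ε ∙ ev f w                            ≈⟨ ∙-congʳ (≈-sym (evL-invL f x)) ⟩
    (evL f x ∙ evL f (invL x)) ∙ ev f w   ≈⟨ assoc _ _ _ ⟩
    evL f x ∙ (evL f (invL x) ∙ ev f w)   ∎

  ev-reduce : ∀ f w → ev f (reduce w) ≈ ev f w
  ev-reduce f []      = ≈-refl
  ev-reduce f (x ∷ w) = ≈-trans (ev-push f x (reduce w)) (∙-congˡ (ev-reduce f w))

  ev-resp : ∀ f w v → w ≈F v → ev f w ≈ ev f v
  ev-resp f w v w≈v = begin
    ev f w           ≈⟨ ≈-sym (ev-reduce f w) ⟩
    ev f (reduce w)  ≡⟨ cong (ev f) w≈v ⟩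
    ev f (reduce v)  ≈⟨ ev-reduce f v ⟩
    ev f v           ∎

  ev-hom : ∀ f → IsHom G (ev f)
  ev-hom f = ev-resp f , ev-++ f

  ev-cong : ∀ f g → (∀ m → f m ≈ g m) → ∀ w → ev f w ≈ ev g w
  ev-cong f g f≈g []               = ≈-refl
  ev-cong f g f≈g ((m , true) ∷ w)  = ∙-cong (f≈g m) (ev-cong f g f≈g w)
  ev-cong f g f≈g ((m , false) ∷ w) = ∙-cong (⁻¹-cong (f≈g m)) (ev-cong f g f≈g w)

  hom-ε : ∀ h → IsHom G h → h [] ≈ ε
  hom-ε h (_ , h-∙) = identityʳ-unique (h []) (h []) (≈-sym (h-∙ [] []))

  hom-inv : ∀ h → IsHom G h → ∀ w → h (inv w) ≈ h w ⁻¹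
  hom-inv h H@(h-resp , h-∙) w = inverseˡ-unique _ _ (begin
    h (inv w) ∙ h w  ≈⟨ ≈-sym (h-∙ (inv w) w) ⟩
    h (inv w ++ w)   ≈⟨ h-resp _ _ (inv-inverseˡ w) ⟩
    h []             ≈⟨ hom-ε h H ⟩
    ε                ∎)

gen : ℕ → Word
gen m = (m , true) ∷ []

Sub : (ℕ → Word) → Word → Word
Sub = Evaluation.ev F

Sub-resp : ∀ γ w v → w ≈F v → Sub γ w ≈F Sub γ v
Sub-resp = Evaluation.ev-resp F

Sub-++ : ∀ γ w v → Sub γ (w ++ v) ≡ Sub γ w ++ Sub γ v
Sub-++ γ []      v = refl
Sub-++ γ (x ∷ w) v =
  trans (cong (Evaluation.evL F γ x ++_) (Sub-++ γ w v)) (sym (++-assoc (Evaluation.evL F γ x) _ _))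

Sub-gen-at : ∀ γ m → Sub γ (gen m) ≈F γ m
Sub-gen-at γ m = cong reduce (++-identityʳ (γ m))

FixedBy : (ℕ → Word) → Word → Set
FixedBy γ w = All (λ x → γ (proj₁ x) ≡ gen (proj₁ x)) w

Sub-fixed : ∀ γ w → FixedBy γ w → Sub γ w ≡ w
Sub-fixed γ []               []       = refl
Sub-fixed γ ((m , true) ∷ w)  (e ∷ es) = cong₂ _++_ e (Sub-fixed γ w es)
Sub-fixed γ ((m , false) ∷ w) (e ∷ es) = cong₂ _++_ (cong inv e) (Sub-fixed γ w es)

Sub-gen : ∀ w → Sub gen w ≡ w
Sub-gen w = Sub-fixed gen w (All.universal (λ _ → refl) w)

module Substitution (G : Group 0ℓ 0ℓ) where
  open Group G renaming (refl to ≈-refl; sym to ≈-sym; trans to ≈-trans)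
  open Evaluation G

  hom-Sub : ∀ h → IsHom G h → (γ : ℕ → Word) → ∀ w → h (Sub γ w) ≈ ev (λ m → h (γ m)) w
  hom-Sub h H γ []               = hom-ε h H
  hom-Sub h H γ ((m , true) ∷ w)  = ≈-trans (proj₂ H _ _) (∙-congˡ (hom-Sub h H γ w))
  hom-Sub h H γ ((m , false) ∷ w) =
    ≈-trans (proj₂ H _ _) (∙-cong (hom-inv h H (γ m)) (hom-Sub h H γ w))

  hom-∘-Sub : ∀ h → IsHom G h → (γ : ℕ → Word) → IsHom G (λ w → h (Sub γ w))
  hom-∘-Sub h (h-resp , h-∙) γ =
    (λ w v w≈v → h-resp _ _ (Sub-resp γ w v w≈v)) ,
    (λ w v → ≈-trans (h-resp _ _ (Evaluation.ev-++ F γ w v)) (h-∙ _ _))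

std-basis : IsBasis gen
std-basis G f = (ev f , ev-hom f , λ m → identityʳ (f m)) , unique
  where
  open Group G renaming (refl to ≈-refl; sym to ≈-sym; trans to ≈-trans)
  open Evaluation G
  open Substitution G
  is-ev : ∀ h → IsHom G h → (∀ m → h (gen m) ≈ f m) → ∀ w → h w ≈ ev f w
  is-ev h H h-gen w = ≈-trans (proj₁ H _ _ (cong reduce (sym (Sub-gen w))))
    (≈-trans (hom-Sub h H gen w) (ev-cong _ _ h-gen w))
  unique : ∀ h h′ → IsHom G h → IsHom G h′ → (∀ m → h (gen m) ≈ f m) → (∀ m → h′ (gen m) ≈ f m)
         → ∀ w → h w ≈ h′ w
  unique h h′ H H′ h-gen h′-gen w = ≈-trans (is-ev h H h-gen w) (≈-sym (is-ev h′ H′ h′-gen w))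

transport : (β : ℕ → Word) → IsBasis β → (ρ π : ℕ → Word)
  → (∀ m → Sub π (ρ m) ≈F gen m) → (∀ m → Sub ρ (π m) ≈F gen m)
  → IsBasis (λ m → Sub β (ρ m))
transport β B ρ π πρ ρπ G f = (h , H , h-extends) , unique
  where
  open Group G renaming (refl to ≈-refl; sym to ≈-sym; trans to ≈-trans)
  open Evaluation G
  open Substitution G
  open import Relation.Binary.Reasoning.Setoid setoid
  -- the values the extension must take on the old basis β
  g : ℕ → Carrier
  g m = ev f (π m)
  h : Word → Carrier
  h = proj₁ (proj₁ (B G g))
  H : IsHom G h
  H = proj₁ (proj₂ (proj₁ (B G g)))
  h-β : ∀ m → h (β m) ≈ g m
  h-β = proj₂ (proj₂ (proj₁ (B G g)))
  h-extends : ∀ m → h (Sub β (ρ m)) ≈ f m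
  h-extends m = begin
    h (Sub β (ρ m))        ≈⟨ hom-Sub h H β (ρ m) ⟩
    ev (λ n → h (β n)) (ρ m) ≈⟨ ev-cong _ _ h-β (ρ m) ⟩
    ev g (ρ m)             ≈⟨ ≈-sym (hom-Sub (ev f) (ev-hom f) π (ρ m)) ⟩
    ev f (Sub π (ρ m))     ≈⟨ ev-resp f (Sub π (ρ m)) (gen m) (πρ m) ⟩
    f m ∙ ε                ≈⟨ identityʳ (f m) ⟩
    f m                    ∎
  on-β : ∀ k → IsHom G k → (∀ m → k (Sub β (ρ m)) ≈ f m) → ∀ m → k (β m) ≈ g m
  on-β k K k-extends m = begin
    k (β m)                ≈⟨ proj₁ K _ _ β-recovered ⟩
    k (Sub β (Sub ρ (π m))) ≈⟨ hom-Sub (λ w → k (Sub β w)) (hom-∘-Sub k K β) ρ (π m) ⟩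
    ev (λ n → k (Sub β (ρ n))) (π m) ≈⟨ ev-cong _ _ k-extends (π m) ⟩
    g m                    ∎
    where
    β-recovered : β m ≈F Sub β (Sub ρ (π m))
    β-recovered = trans (sym (Sub-gen-at β m)) (Sub-resp β (gen m) (Sub ρ (π m)) (sym (ρπ m)))
  unique : ∀ k k′ → IsHom G k → IsHom G k′
         → (∀ m → k (Sub β (ρ m)) ≈ f m) → (∀ m → k′ (Sub β (ρ m)) ≈ f m)
         → ∀ w → k w ≈ k′ w
  unique k k′ K K′ k-ext k′-ext = proj₂ (B G g) k k′ K K′ (on-β k K k-ext) (on-β k′ K′ k′-ext)

assign : ℕ → Word → ℕ → Word
assign r R m with m ≟ r
... | yes _ = R
... | no  _ = gen m

assign-at : ∀ r R → assign r R r ≡ R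
assign-at r R with r ≟ r
... | yes _   = refl
... | no  r≢r = ⊥-elim (r≢r refl)

assign-away : ∀ r R m → m ≢ r → assign r R m ≡ gen m
assign-away r R m m≢r with m ≟ r
... | yes m≡r = ⊥-elim (m≢r m≡r)
... | no  _   = refl

at-or-away : ∀ r (P : ℕ → Set) → P r → (∀ m → m ≢ r → P m) → ∀ m → P m
at-or-away r P at away m with m ≟ r
... | yes refl = at
... | no  m≢r  = away m m≢r

assign-assign-away : ∀ r X Y m → m ≢ r → Sub (assign r X) (assign r Y m) ≈F gen m
assign-assign-away r X Y m m≢r =
  trans (cong (λ t → reduce (Sub (assign r X) t)) (assign-away r Y m m≢r))
        (trans (Sub-gen-at (assign r X) m) (cong reduce (assign-away r X m m≢r)))

FreeOf : ℕ → Word → Set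
FreeOf r w = All (λ x → proj₁ x ≢ r) w

free-inv : ∀ r w → FreeOf r w → FreeOf r (inv w)
free-inv r []      []            = []
free-inv r (x ∷ w) (x≢r ∷ w-free) = ++⁺ (free-inv r w w-free) (x≢r ∷ [])

free⇒fixed : ∀ r R w → FreeOf r w → FixedBy (assign r R) w
free⇒fixed r R w = All.map (λ {x} x≢r → assign-away r R (proj₁ x) x≢r)

data OccursOnce (r : ℕ) : Word → Set where
  once : ∀ {u v} s → FreeOf r u → FreeOf r v → OccursOnce r (u ++ (r , s) ∷ v)

_⟨_≔_⟩ : (ℕ → Word) → ℕ → Word → ℕ → Word
(β ⟨ r ≔ W ⟩) m = Sub β (assign r W m)

replace-at : ∀ β r W → (β ⟨ r ≔ W ⟩) r ≡ Sub β W
replace-at β r W = cong (Sub β) (assign-at r W)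

replace-away : ∀ β r W m → m ≢ r → (β ⟨ r ≔ W ⟩) m ≈F β m
replace-away β r W m m≢r =
  trans (cong (λ t → reduce (Sub β t)) (assign-away r W m m≢r)) (Sub-gen-at β m)

cancel-around : ∀ u x v → (u ++ (inv u ++ x ∷ inv v) ++ v) ≈F (x ∷ [])
cancel-around u x v = begin
  reduce (u ++ (inv u ++ x ∷ inv v) ++ v)  ≡⟨ cong (λ t → reduce (u ++ t)) (++-assoc (inv u) _ v) ⟩
  reduce (u ++ inv u ++ x ∷ inv v ++ v)    ≡⟨ inv-cancelʳ u (x ∷ inv v ++ v) ⟩
  push x (reduce (inv v ++ v))             ≡⟨ cong (push x) (inv-inverseˡ v) ⟩
  x ∷ []                                   ∎
  where open ≡-Reasoning

cancel-within : ∀ u x v → (inv u ++ (u ++ x ∷ v) ++ inv v) ≈F (x ∷ [])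
cancel-within u x v = begin
  reduce (inv u ++ (u ++ x ∷ v) ++ inv v)  ≡⟨ cong (λ t → reduce (inv u ++ t)) (++-assoc u _ (inv v)) ⟩
  reduce (inv u ++ u ++ x ∷ v ++ inv v)    ≡⟨ inv-cancelˡ u (x ∷ v ++ inv v) ⟩
  push x (reduce (v ++ inv v))             ≡⟨ cong (push x) (inv-inverseʳ v) ⟩
  x ∷ []                                   ∎
  where open ≡-Reasoning

orient : Bool → Word → Word
orient true  w = w
orient false w = inv w

-- A Nielsen move x_r ↦ u x_r^s v (x_r not in u, v) is inverted by
-- x_r ↦ (u⁻¹ x_r v⁻¹)^s, so it preserves bases.
nielsen : ∀ β r W → IsBasis β → OccursOnce r W → IsBasis (β ⟨ r ≔ W ⟩)
nielsen β r _ B (once {u} {v} s u-free v-free) = transport β B ρ π πρ ρπ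
  where
  W : Word
  W = u ++ (r , s) ∷ v
  C : Word
  C = inv u ++ (r , true) ∷ inv v
  ρ π : ℕ → Word
  ρ = assign r W
  π = assign r (orient s C)
  π-letter : ∀ t → Evaluation.evL F (assign r (orient t C)) (r , t) ≡ C
  π-letter true  = assign-at r C
  π-letter false = trans (cong inv (assign-at r (inv C))) (inv-involutive C)
  π-W : Sub π W ≡ u ++ C ++ v
  π-W = trans (Sub-++ π u ((r , s) ∷ v))
    (cong₂ _++_ (Sub-fixed π u (free⇒fixed r _ u u-free))
                (cong₂ _++_ (π-letter s) (Sub-fixed π v (free⇒fixed r _ v v-free))))
  ρ-C : Sub ρ C ≡ inv u ++ W ++ inv v
  ρ-C = trans (Sub-++ ρ (inv u) ((r , true) ∷ inv v))
    (cong₂ _++_ (Sub-fixed ρ (inv u) (free⇒fixed r W (inv u) (free-inv r u u-free)))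
                (cong₂ _++_ (assign-at r W) (Sub-fixed ρ (inv v) (free⇒fixed r W (inv v) (free-inv r v v-free)))))
  ρ-orient : ∀ t → Sub ρ C ≈F ((r , t) ∷ []) → Sub ρ (orient t C) ≈F gen r
  ρ-orient true  ρC≈ = ρC≈
  ρ-orient false ρC≈ =
    trans (Evaluation.hom-inv F (Sub ρ) (Evaluation.ev-hom F ρ) C) (inv-cong {Sub ρ C} {(r , false) ∷ []} ρC≈)
  πρ : ∀ m → Sub π (ρ m) ≈F gen m
  πρ = at-or-away r (λ m → Sub π (ρ m) ≈F gen m)
    (trans (cong (λ t → reduce (Sub π t)) (assign-at r W))
           (trans (cong reduce π-W) (cancel-around u (r , true) v)))
    (assign-assign-away r (orient s C) W)
  ρπ : ∀ m → Sub ρ (π m) ≈F gen m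
  ρπ = at-or-away r (λ m → Sub ρ (π m) ≈F gen m)
    (trans (cong (λ t → reduce (Sub ρ t)) (assign-at r (orient s C)))
           (ρ-orient s (trans (cong reduce ρ-C) (cancel-within u (r , s) v))))
    (assign-assign-away r W (orient s C))

disjoint-moves : ∀ {r₁ r₂ W₁ W₂} → r₁ ≢ r₂ → OccursOnce r₁ W₁ → OccursOnce r₂ W₂
  → FreeOf r₁ W₂ → PartOfBasis W₁ W₂
disjoint-moves {r₁} {r₂} {W₁} {W₂} r₁≢r₂ once₁ once₂ W₂-free =
  ℕ , β₂ , nielsen β₁ r₂ W₂ (nielsen gen r₁ W₁ std-basis once₁) once₂ ,
  r₁ , r₂ , r₁≢r₂ , β₂-r₁ , cong reduce β₂-r₂
  where
  β₁ β₂ : ℕ → Word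
  β₁ = gen ⟨ r₁ ≔ W₁ ⟩
  β₂ = β₁ ⟨ r₂ ≔ W₂ ⟩
  β₂-r₁ : β₂ r₁ ≈F W₁
  β₂-r₁ = trans (replace-away β₁ r₂ W₂ r₁ r₁≢r₂)
                (cong reduce (trans (replace-at gen r₁ W₁) (Sub-gen W₁)))
  β₂-r₂ : β₂ r₂ ≡ W₂
  β₂-r₂ = trans (replace-at β₁ r₂ W₂)
    (Sub-fixed β₁ W₂ (All.map (λ {x} x≢r₁ → cong (Sub gen) (assign-away r₁ W₁ (proj₁ x) x≢r₁)) W₂-free))

PartOfBasis-sym : ∀ {x y} → PartOfBasis x y → PartOfBasis y x
PartOfBasis-sym (I , β , B , p , q , p≢q , βp , βq) = I , β , B , q , p , ≢-sym p≢q , βq , βp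

-- The exponent sum of a word is invariant under free reduction, so words
-- with different exponent sums are different elements of F_ω.
ℤ-group : Group 0ℓ 0ℓ
ℤ-group = AbelianGroup.group +-0-abelianGroup

exponent-sum : Word → ℤ
exponent-sum = Evaluation.ev ℤ-group (λ _ → + 1)

exponent-sum-resp : ∀ w v → w ≈F v → exponent-sum w ≡ exponent-sum v
exponent-sum-resp = Evaluation.ev-resp ℤ-group (λ _ → + 1)

-- a_ij has exponent sum 6 and b_kl has exponent sum −5.
distinct : ∀ {n} (i j k l : Fin n) → ¬ (a i j ≈F b k l)
distinct i j k l a≈b with exponent-sum-resp (a i j) (b k l) a≈b
... | ()

below-shift : ∀ m t → m < m + suc t
below-shift m t = m<m+n m z<s

a-once : ∀ {n} (i j : Fin n) → OccursOnce (toℕ i) (a i j)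
a-once i j = once {u = p ∷ p ∷ p ∷ p ∷ p ∷ []} {v = []} true (p≢q ∷ p≢q ∷ p≢q ∷ p≢q ∷ p≢q ∷ []) []
  where
  p : Letter
  p = toℕ i + suc (toℕ j) , true
  p≢q : toℕ i + suc (toℕ j) ≢ toℕ i
  p≢q = >⇒≢ (below-shift (toℕ i) (toℕ j))

b-once : ∀ {n} (k l : Fin n) → OccursOnce (toℕ k) (b k l)
b-once k l = once {u = []} {v = s ∷ s ∷ s ∷ s ∷ []} false [] (s≢r ∷ s≢r ∷ s≢r ∷ s≢r ∷ [])
  where
  s : Letter
  s = toℕ k + suc (toℕ l) , false
  s≢r : toℕ k + suc (toℕ l) ≢ toℕ k
  s≢r = >⇒≢ (below-shift (toℕ k) (toℕ l))

-- (i,j) = (k,l): replace e_i by b_ij, then e_{i+j} by e_{i+j} e_i⁻¹, which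
-- becomes e_{i+j} b_ij⁻¹ = a_ij.
same-indices : ∀ {n} (i j : Fin n) → PartOfBasis (a i j) (b i j)
same-indices i j =
  ℕ , β₂ , nielsen β₁ p _ (nielsen gen q (b i j) std-basis (b-once i j)) p-once ,
  p , q , p≢q , cong reduce β₂-p , β₂-q
  where
  q p : ℕ
  q = toℕ i
  p = q + suc (toℕ j)
  p≢q : p ≢ q
  p≢q = >⇒≢ (below-shift q (toℕ j))
  p-once : OccursOnce p ((p , true) ∷ (q , false) ∷ [])
  p-once = once {u = []} {v = (q , false) ∷ []} true [] (≢-sym p≢q ∷ [])
  β₁ β₂ : ℕ → Word
  β₁ = gen ⟨ q ≔ b i j ⟩
  β₂ = β₁ ⟨ p ≔ (p , true) ∷ (q , false) ∷ [] ⟩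
  β₁-q : β₁ q ≡ b i j
  β₁-q = trans (replace-at gen q (b i j)) (Sub-gen (b i j))
  β₁-p : β₁ p ≡ gen p
  β₁-p = cong (Sub gen) (assign-away q (b i j) p p≢q)
  β₂-p : β₂ p ≡ a i j
  β₂-p = trans (replace-at β₁ p _) (cong₂ (λ x y → x ++ inv y ++ []) β₁-p β₁-q)
  β₂-q : β₂ q ≈F b i j
  β₂-q = trans (replace-away β₁ p _ q (≢-sym p≢q)) (cong reduce β₁-q)

-- i ≠ k: the moves producing a_ij (at e_i) and b_kl (at e_k) are disjoint.
-- If e_i does not occur in b_kl, perform the a-move first; otherwise
-- k + l = i, so k < i < i + j and e_k does not occur in a_ij.
different-indices : ∀ {n} (i j k l : Fin n) → i ≢ k → PartOfBasis (a i j) (b k l)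
different-indices i j k l i≢k with toℕ k + suc (toℕ l) ≟ toℕ i
... | no s≢q = disjoint-moves q≢r (a-once i j) (b-once k l) (r≢q ∷ s≢q ∷ s≢q ∷ s≢q ∷ s≢q ∷ [])
  where
  q≢r : toℕ i ≢ toℕ k
  q≢r q≡r = i≢k (toℕ-injective q≡r)
  r≢q : toℕ k ≢ toℕ i
  r≢q = ≢-sym q≢r
... | yes s≡q = PartOfBasis-sym {b k l} {a i j}
  (disjoint-moves r≢q (b-once k l) (a-once i j) (p≢r ∷ p≢r ∷ p≢r ∷ p≢r ∷ p≢r ∷ q≢r ∷ []))
  where
  q≢r : toℕ i ≢ toℕ k
  q≢r q≡r = i≢k (toℕ-injective q≡r)
  r≢q : toℕ k ≢ toℕ i
  r≢q = ≢-sym q≢r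
  p≢r : toℕ i + suc (toℕ j) ≢ toℕ k
  p≢r = >⇒≢ (<-trans (below-shift (toℕ k) (toℕ l))
                     (subst (_< toℕ i + suc (toℕ j)) (sym s≡q) (below-shift (toℕ i) (toℕ j))))

lemma3p5 : (n : ℕ) (i j k l : Fin n) → (i ≢ k) ⊎ (i ≡ k × j ≡ l)
    → ¬ (a i j ≈F b k l) × PartOfBasis (a i j) (b k l)
lemma3p5 n i j k l (inj₁ i≢k)             = distinct i j k l , different-indices i j k l i≢k
lemma3p5 n i j k l (inj₂ (refl , refl)) = distinct i j k l , same-indices i j
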